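{- For any $k,n\in\mathbb N$, $$\frac{k}{\binom{2k-1}k}\binom nk\binom{ -n}k\equiv0\pmod n,$$ i.e. this quantity is an integer divisible by $n$.
   Context: For an integer $x$ and $k\in\mathbb N$, $\binom xk=x(x-1)\cdots(x-k+1)/k!$; in particular $\binom{ -1}{0}=1$. -}

module Defs where

open import Data.Nat using (ℕ; zero; suc; _!)
open import Data.Nat.Properties using (_!≢0)
open import Data.Integer using (ℤ; +_; _-_; _*_)
open import Data.Rational using (ℚ; _/_)

fallingℤ : ℤ → ℕ → ℤ
fallingℤ x zero    = + 1
fallingℤ x (suc k) = fallingℤ x k * (x - + k)

binom : ℤ → ℕ → ℚ
binom x k = _/_ (fallingℤ x k) (k !) {{k !≢0}}

module Submission where

-- The proof rests on the reflection identity for falling factorials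
--   x^(k) · (-x)^(k) = (-1)^k · x · (x + k - 1)^(2k-1),
-- where y^(j) = y(y-1)…(y-j+1): pairing the factor x - i of x^(k) with the
-- factor -x - i of (-x)^(k) and reordering gives (-1)^k x·(x+k-1)…(x-k+1).
-- Dividing by (k!)^2 and using  binom(2k-1,k) = (2k-1)!/(k!(k-1)!)  yields
--   k/binom(2k-1,k) · binom(n,k) · binom(-n,k) = (-1)^k · n · C(n+k-1, 2k-1),
-- an integer multiple of n.  Two facts about falling factorials of naturals
-- provide the integrality: y^(j) = C(y,j)·j!  and  (b+a)^(b) · a! = (b+a)!.

open import Defs
open import Data.Nat using (ℕ)
open import Data.Integer using (ℤ; +_; -_; _-_)
open import Data.Integer.Divisibility using (_∣_)
open import Data.Rational using (ℚ; _*_; _/_)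
open import Data.Product using (∃; _×_)
open import Relation.Binary.PropositionalEquality using (_≡_)

import Data.Nat as ℕ
open import Data.Nat using (zero; suc; _!; NonZero)
open import Data.Nat.Combinatorics using (_C_; nCk+nC[k+1]≡[n+1]C[k+1])
open import Data.Nat.Properties using (_!≢0)
import Data.Nat.Properties as ℕP
import Data.Nat.Divisibility as ℕD
import Data.Integer as ℤ
open import Data.Integer using (_^_; -1ℤ)
import Data.Integer.Properties as ℤP
open import Data.Integer.Tactic.RingSolver using (solve-∀)
open import Data.Rational using (toℚᵘ)
open import Data.Rational.Unnormalised as ℚᵘ using (mkℚᵘ; *≡*)
import Data.Rational.Unnormalised.Properties as ℚᵘP
import Data.Rational.Properties as ℚP
open import Data.Product using (_,_)
open import Relation.Binary.PropositionalEquality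
  using (refl; sym; trans; cong; cong₂; module ≡-Reasoning)

falling-suc : ∀ (x : ℤ) j →
  fallingℤ (+ 1 ℤ.+ x) (suc j) ≡ (+ 1 ℤ.+ x) ℤ.* fallingℤ x j
falling-suc x zero    = top-only x
  where
  top-only : ∀ (x : ℤ) → + 1 ℤ.* (+ 1 ℤ.+ x - + 0) ≡ (+ 1 ℤ.+ x) ℤ.* + 1
  top-only = solve-∀
falling-suc x (suc j) = begin
  fallingℤ (+ 1 ℤ.+ x) (suc j) ℤ.* (+ 1 ℤ.+ x - + suc j)
    ≡⟨ cong (ℤ._* (+ 1 ℤ.+ x - + suc j)) (falling-suc x j) ⟩
  (+ 1 ℤ.+ x) ℤ.* fallingℤ x j ℤ.* (+ 1 ℤ.+ x - + suc j)
    ≡⟨ shift x (fallingℤ x j) (+ j) ⟩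
  (+ 1 ℤ.+ x) ℤ.* (fallingℤ x j ℤ.* (x - + j)) ∎
  where
  open ≡-Reasoning
  shift : ∀ (x F J : ℤ) →
    (+ 1 ℤ.+ x) ℤ.* F ℤ.* (+ 1 ℤ.+ x - (+ 1 ℤ.+ J)) ≡ (+ 1 ℤ.+ x) ℤ.* (F ℤ.* (x - J))
  shift = solve-∀

falling-zero : ∀ j → fallingℤ (+ 0) (suc j) ≡ + 0
falling-zero zero    = refl
falling-zero (suc j) = cong (ℤ._* (+ 0 - + suc j)) (falling-zero j)

-- For a natural number y:  y^(j) = C(y,j) · j!.  Induction along Pascal's rule,
-- which is the step  (1+x)^(j+1) = (j+1)·x^(j) + x^(j+1).
C*!≡falling : ∀ y j → + (y C j) ℤ.* + (j !) ≡ fallingℤ (+ y) j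
C*!≡falling y       zero    = refl
C*!≡falling zero    (suc j) = sym (falling-zero j)
C*!≡falling (suc x) (suc j) = begin
  + (suc x C suc j) ℤ.* + (suc j !)
    ≡⟨ cong₂ (λ c f → + c ℤ.* f) (sym (nCk+nC[k+1]≡[n+1]C[k+1] x j)) (ℤP.pos-* (suc j) (j !)) ⟩
  + (x C j ℕ.+ x C suc j) ℤ.* (+ suc j ℤ.* + (j !))
    ≡⟨ cong (ℤ._* (+ suc j ℤ.* + (j !))) (ℤP.pos-+ (x C j) (x C suc j)) ⟩
  (+ (x C j) ℤ.+ + (x C suc j)) ℤ.* (+ suc j ℤ.* + (j !))
    ≡⟨ spread (+ (x C j)) (+ (x C suc j)) (+ (j !)) (+ j) ⟩
  + suc j ℤ.* (+ (x C j) ℤ.* + (j !)) ℤ.+ + (x C suc j) ℤ.* (+ suc j ℤ.* + (j !))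
    ≡⟨ cong (λ f → + suc j ℤ.* (+ (x C j) ℤ.* + (j !)) ℤ.+ + (x C suc j) ℤ.* f) (sym (ℤP.pos-* (suc j) (j !))) ⟩
  + suc j ℤ.* (+ (x C j) ℤ.* + (j !)) ℤ.+ + (x C suc j) ℤ.* + (suc j !)
    ≡⟨ cong₂ (λ a b → + suc j ℤ.* a ℤ.+ b) (C*!≡falling x j) (C*!≡falling x (suc j)) ⟩
  + suc j ℤ.* fallingℤ (+ x) j ℤ.+ fallingℤ (+ x) j ℤ.* (+ x - + j)
    ≡⟨ pascal-step (fallingℤ (+ x) j) (+ x) (+ j) ⟩
  (+ 1 ℤ.+ + x) ℤ.* fallingℤ (+ x) j
    ≡⟨ sym (falling-suc (+ x) j) ⟩
  fallingℤ (+ suc x) (suc j) ∎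
  where
  open ≡-Reasoning
  spread : ∀ (a b f J : ℤ) →
    (a ℤ.+ b) ℤ.* ((+ 1 ℤ.+ J) ℤ.* f) ≡ (+ 1 ℤ.+ J) ℤ.* (a ℤ.* f) ℤ.+ b ℤ.* ((+ 1 ℤ.+ J) ℤ.* f)
  spread = solve-∀
  pascal-step : ∀ (F x J : ℤ) → (+ 1 ℤ.+ J) ℤ.* F ℤ.+ F ℤ.* (x - J) ≡ (+ 1 ℤ.+ x) ℤ.* F
  pascal-step = solve-∀

falling*!≡! : ∀ a b → fallingℤ (+ (b ℕ.+ a)) b ℤ.* + (a !) ≡ + ((b ℕ.+ a) !)
falling*!≡! a zero    = ℤP.*-identityˡ (+ (a !))
falling*!≡! a (suc b) = begin
  fallingℤ (+ suc (b ℕ.+ a)) (suc b) ℤ.* + (a !)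
    ≡⟨ cong (ℤ._* + (a !)) (falling-suc (+ (b ℕ.+ a)) b) ⟩
  + suc (b ℕ.+ a) ℤ.* fallingℤ (+ (b ℕ.+ a)) b ℤ.* + (a !)
    ≡⟨ ℤP.*-assoc (+ suc (b ℕ.+ a)) (fallingℤ (+ (b ℕ.+ a)) b) (+ (a !)) ⟩
  + suc (b ℕ.+ a) ℤ.* (fallingℤ (+ (b ℕ.+ a)) b ℤ.* + (a !))
    ≡⟨ cong (+ suc (b ℕ.+ a) ℤ.*_) (falling*!≡! a b) ⟩
  + suc (b ℕ.+ a) ℤ.* + ((b ℕ.+ a) !)
    ≡⟨ sym (ℤP.pos-* (suc (b ℕ.+ a)) ((b ℕ.+ a) !)) ⟩
  + ((suc b ℕ.+ a) !) ∎
  where open ≡-Reasoning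

-- Passing from s to s+1 multiplies the left side by (x-k)(-x-k), which is
-- -(x+k)(x-k): the new top and bottom factors of (x+s+1)^(2s+3).
falling-reflection : ∀ (x : ℤ) s →
  fallingℤ x (suc s) ℤ.* fallingℤ (- x) (suc s)
    ≡ -1ℤ ^ suc s ℤ.* x ℤ.* fallingℤ (x ℤ.+ + s) (suc (s ℕ.+ s))
falling-reflection x zero    = base x
  where
  base : ∀ (x : ℤ) →
    (+ 1 ℤ.* (x - + 0)) ℤ.* (+ 1 ℤ.* (- x - + 0)) ≡ -1ℤ ^ 1 ℤ.* x ℤ.* (+ 1 ℤ.* (x ℤ.+ + 0 - + 0))
  base = solve-∀
falling-reflection x (suc s) = begin
  fallingℤ x (suc s) ℤ.* (x - + suc s) ℤ.* (fallingℤ (- x) (suc s) ℤ.* (- x - + suc s))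
    ≡⟨ regroup (fallingℤ x (suc s)) (fallingℤ (- x) (suc s)) x (+ s) ⟩
  fallingℤ x (suc s) ℤ.* fallingℤ (- x) (suc s) ℤ.* ((x - + suc s) ℤ.* (- x - + suc s))
    ≡⟨ cong (ℤ._* ((x - + suc s) ℤ.* (- x - + suc s))) (falling-reflection x s) ⟩
  ε ℤ.* x ℤ.* G ℤ.* ((x - + suc s) ℤ.* (- x - + suc s))
    ≡⟨ new-ends ε x G (+ s) ⟩
  -1ℤ ℤ.* ε ℤ.* x ℤ.* ((+ 1 ℤ.+ y) ℤ.* G ℤ.* (+ 1 ℤ.+ y - + suc (suc (s ℕ.+ s))))
    ≡⟨ cong (λ f → -1ℤ ℤ.* ε ℤ.* x ℤ.* (f ℤ.* (+ 1 ℤ.+ y - + suc (suc (s ℕ.+ s)))))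
            (sym (falling-suc y (suc (s ℕ.+ s)))) ⟩
  -1ℤ ℤ.* ε ℤ.* x ℤ.* fallingℤ (+ 1 ℤ.+ y) (suc (suc (suc (s ℕ.+ s))))
    ≡⟨ cong₂ (λ z j → -1ℤ ℤ.* ε ℤ.* x ℤ.* fallingℤ z (suc (suc j)))
             (sym (shift-top x (+ s))) (sym (ℕP.+-suc s s)) ⟩
  -1ℤ ℤ.* ε ℤ.* x ℤ.* fallingℤ (x ℤ.+ + suc s) (suc (suc s ℕ.+ suc s)) ∎
  where
  open ≡-Reasoning
  ε = -1ℤ ^ suc s
  y = x ℤ.+ + s
  G = fallingℤ y (suc (s ℕ.+ s))
  regroup : ∀ (P Q x S : ℤ) →
    P ℤ.* (x - (+ 1 ℤ.+ S)) ℤ.* (Q ℤ.* (- x - (+ 1 ℤ.+ S)))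
      ≡ P ℤ.* Q ℤ.* ((x - (+ 1 ℤ.+ S)) ℤ.* (- x - (+ 1 ℤ.+ S)))
  regroup = solve-∀
  new-ends : ∀ (e x G S : ℤ) →
    e ℤ.* x ℤ.* G ℤ.* ((x - (+ 1 ℤ.+ S)) ℤ.* (- x - (+ 1 ℤ.+ S)))
      ≡ - (+ 1) ℤ.* e ℤ.* x ℤ.* ((+ 1 ℤ.+ (x ℤ.+ S)) ℤ.* G ℤ.* (+ 1 ℤ.+ (x ℤ.+ S) - (+ 1 ℤ.+ (+ 1 ℤ.+ (S ℤ.+ S)))))
  new-ends = solve-∀
  shift-top : ∀ (x S : ℤ) → x ℤ.+ (+ 1 ℤ.+ S) ≡ + 1 ℤ.+ (x ℤ.+ S)
  shift-top = solve-∀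

-- The rational a/d is, up to ≃, the unnormalised fraction a/d (a / d is
-- defined as the normalisation of that fraction).
toℚᵘ-/ : ∀ a d .{{_ : NonZero d}} → toℚᵘ (a / d) ℚᵘ.≃ mkℚᵘ a (ℕ.pred d)
toℚᵘ-/ a (suc d) = ℚP.toℚᵘ-fromℚᵘ (mkℚᵘ a d)

cross-multiply : ∀ (m A K B B′ : ℤ) (D : ℕ) .{{_ : NonZero D}} →
  m ℤ.* A ℤ.* (+ D ℤ.* + D) ≡ K ℤ.* B ℤ.* B′ ℤ.* + D →
  (m / 1) * (A / D) ≡ (K / 1) * (B / D) * (B′ / D)
cross-multiply m A K B B′ D@(suc d) eq = ℚP.toℚᵘ-injective (begin
  toℚᵘ ((m / 1) * (A / D))
    ≈⟨ ℚP.toℚᵘ-homo-* (m / 1) (A / D) ⟩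
  toℚᵘ (m / 1) ℚᵘ.* toℚᵘ (A / D)
    ≈⟨ ℚᵘP.*-cong (toℚᵘ-/ m 1) (toℚᵘ-/ A D) ⟩
  mkℚᵘ m 0 ℚᵘ.* mkℚᵘ A d
    ≈⟨ *≡* cleared ⟩
  mkℚᵘ K 0 ℚᵘ.* mkℚᵘ B d ℚᵘ.* mkℚᵘ B′ d
    ≈⟨ ℚᵘP.*-cong (ℚᵘP.*-cong (toℚᵘ-/ K 1) (toℚᵘ-/ B D)) (toℚᵘ-/ B′ D) ⟨
  toℚᵘ (K / 1) ℚᵘ.* toℚᵘ (B / D) ℚᵘ.* toℚᵘ (B′ / D)
    ≈⟨ ℚᵘP.*-cong (ℚP.toℚᵘ-homo-* (K / 1) (B / D)) ℚᵘP.≃-refl ⟨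
  toℚᵘ ((K / 1) * (B / D)) ℚᵘ.* toℚᵘ (B′ / D)
    ≈⟨ ℚP.toℚᵘ-homo-* ((K / 1) * (B / D)) (B′ / D) ⟨
  toℚᵘ ((K / 1) * (B / D) * (B′ / D)) ∎)
  where
  open ℚᵘP.≃-Reasoning
  cleared : m ℤ.* A ℤ.* + (1 ℕ.* D ℕ.* D) ≡ K ℤ.* B ℤ.* B′ ℤ.* + (1 ℕ.* D)
  cleared = trans (cong (λ e → m ℤ.* A ℤ.* e) (trans (cong (λ e → + (e ℕ.* D)) (ℕP.*-identityˡ D)) (ℤP.pos-* D D)))
                  (trans eq (cong (λ e → K ℤ.* B ℤ.* B′ ℤ.* + e) (sym (ℕP.*-identityˡ D))))

-- Writing k! = k·s!, the factor (2s+1)^(k)·s! becomes (2s+1)!, which with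
-- C(n+s,2s+1) rebuilds (n+s)^(2s+1); reflection then gives n^(k)·(-n)^(k).
cleared-identity : ∀ n s →
  let m = + n ℤ.* (-1ℤ ^ suc s ℤ.* + ((n ℕ.+ s) C suc (s ℕ.+ s))) in
  m ℤ.* fallingℤ (+ suc (s ℕ.+ s)) (suc s) ℤ.* (+ (suc s !) ℤ.* + (suc s !))
    ≡ + suc s ℤ.* fallingℤ (+ n) (suc s) ℤ.* fallingℤ (- + n) (suc s) ℤ.* + (suc s !)
cleared-identity n s = begin
  N ℤ.* (ε ℤ.* c) ℤ.* A ℤ.* (D ℤ.* D)
    ≡⟨ cong (λ z → N ℤ.* (ε ℤ.* c) ℤ.* A ℤ.* (z ℤ.* z)) D≡K*T ⟩
  N ℤ.* (ε ℤ.* c) ℤ.* A ℤ.* ((K ℤ.* T) ℤ.* (K ℤ.* T))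
    ≡⟨ regroup N ε c A K T ⟩
  ε ℤ.* N ℤ.* c ℤ.* K ℤ.* (K ℤ.* T) ℤ.* (A ℤ.* T)
    ≡⟨ cong₂ (λ a b → ε ℤ.* N ℤ.* c ℤ.* K ℤ.* a ℤ.* b) (sym D≡K*T) (falling*!≡! s (suc s)) ⟩
  ε ℤ.* N ℤ.* c ℤ.* K ℤ.* D ℤ.* + (suc (s ℕ.+ s) !)
    ≡⟨ regroup′ N ε c (+ (suc (s ℕ.+ s) !)) K D ⟩
  K ℤ.* (ε ℤ.* N ℤ.* (c ℤ.* + (suc (s ℕ.+ s) !))) ℤ.* D
    ≡⟨ cong (λ z → K ℤ.* (ε ℤ.* N ℤ.* z) ℤ.* D) (C*!≡falling (n ℕ.+ s) (suc (s ℕ.+ s))) ⟩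
  K ℤ.* (ε ℤ.* N ℤ.* fallingℤ (N ℤ.+ + s) (suc (s ℕ.+ s))) ℤ.* D
    ≡⟨ cong (λ z → K ℤ.* z ℤ.* D) (sym (falling-reflection N s)) ⟩
  K ℤ.* (fallingℤ N (suc s) ℤ.* fallingℤ (- N) (suc s)) ℤ.* D
    ≡⟨ cong (ℤ._* D) (sym (ℤP.*-assoc K (fallingℤ N (suc s)) (fallingℤ (- N) (suc s)))) ⟩
  K ℤ.* fallingℤ N (suc s) ℤ.* fallingℤ (- N) (suc s) ℤ.* D ∎
  where
  open ≡-Reasoning
  N = + n
  ε = -1ℤ ^ suc s
  c = + ((n ℕ.+ s) C suc (s ℕ.+ s))
  A = fallingℤ (+ suc (s ℕ.+ s)) (suc s)
  K = + suc s
  T = + (s !)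
  D = + (suc s !)
  D≡K*T : D ≡ K ℤ.* T
  D≡K*T = ℤP.pos-* (suc s) (s !)
  regroup : ∀ (N e c A K T : ℤ) →
    N ℤ.* (e ℤ.* c) ℤ.* A ℤ.* ((K ℤ.* T) ℤ.* (K ℤ.* T)) ≡ e ℤ.* N ℤ.* c ℤ.* K ℤ.* (K ℤ.* T) ℤ.* (A ℤ.* T)
  regroup = solve-∀
  regroup′ : ∀ (N e c P K D : ℤ) →
    e ℤ.* N ℤ.* c ℤ.* K ℤ.* D ℤ.* P ≡ K ℤ.* (e ℤ.* N ℤ.* (c ℤ.* P)) ℤ.* D
  regroup′ = solve-∀

2k-1≡2s+1 : ∀ s → (+ 2 ℤ.* + suc s) - + 1 ≡ + suc (s ℕ.+ s)
2k-1≡2s+1 s = trans (arith (+ s)) (sym (ℤP.pos-+ 1 (s ℕ.+ s)))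
  where
  arith : ∀ (S : ℤ) → (+ 2 ℤ.* (+ 1 ℤ.+ S)) - + 1 ≡ + 1 ℤ.+ (S ℤ.+ S)
  arith = solve-∀

∣n*x : ∀ n x → + n ∣ + n ℤ.* x
∣n*x n x = ℕD.divides ℤ.∣ x ∣ (trans (ℤP.abs-* (+ n) x) (ℕP.*-comm n ℤ.∣ x ∣))

lemma4p1 : (k n : ℕ) → ∃ λ (m : ℤ) → (+ n ∣ m)
    × ((m / 1) * binom ((+ 2 Data.Integer.* + k) - + 1) k ≡ ((+ k) / 1) * binom (+ n) k * binom (- (+ n)) k)
lemma4p1 zero    n = + 0 , n ℕD.∣0 , refl
lemma4p1 (suc s) n = + n ℤ.* x , ∣n*x n x , identity
  where
  x = -1ℤ ^ suc s ℤ.* + ((n ℕ.+ s) C suc (s ℕ.+ s))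
  identity : ((+ n ℤ.* x) / 1) * binom ((+ 2 ℤ.* + suc s) - + 1) (suc s)
               ≡ ((+ suc s) / 1) * binom (+ n) (suc s) * binom (- (+ n)) (suc s)
  identity = trans (cong (λ a → ((+ n ℤ.* x) / 1) * binom a (suc s)) (2k-1≡2s+1 s))
                   (cross-multiply (+ n ℤ.* x) (fallingℤ (+ suc (s ℕ.+ s)) (suc s)) (+ suc s)
                      (fallingℤ (+ n) (suc s)) (fallingℤ (- + n) (suc s)) (suc s !) {{suc s !≢0}}
                      (cleared-identity n s))
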